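{- A pair $X=(T,T')\in\mathcal{T}_n\times\mathcal{T}_n$ is a Kreweras interval if and only if $\phi(X)$ is a meandering tree without non-Kreweras pairs, where a non-Kreweras pair is a lower arc with ends $x_\ell<x_r$ and an upper arc with ends $x'_\ell<x'_r$ such that $x_\ell<x'_\ell<x_r<x'_r$.
   Context: A binary tree is either a single leaf or a node with an ordered pair (left, right) of binary subtrees; size = number of nodes; $\mathcal{T}_n$ = binary trees of size $n$. Label the nodes of $T$ as $v_1,\dots,v_n$ (equivalently $1,\dots,n$) in infix order; $a_t(T)$, $b_t(T)$ are the sizes of the right and left subtrees of $v_t$. $\iota(T)$ is the set partition of $[n]$ into the label sets of the maximal chains of right-child edges (right branches) of $T$; it is a non-crossing partition. $(T,T')$ is a Kreweras interval if $\iota(T)\le\iota(T')$ in the refinement order (every block of $\iota(T)$ is contained in a block of $\iota(T')$). $\phi(T,T')$ is the arc-diagram on the points $0,\tfrac12,\dots,n$ (integers black, half-integers white) with, for each $t\in[n]$, an upper arc (semicircle in the upper half-plane) joining $t-\tfrac12$ to $t-1-b_t(T')$ and a lower arc (in the lower half-plane) joining $t-\tfrac12$ to $t+a_t(T)$. Its underlying graph has the black points as vertices and, for each white point, an edge joining the black ends of its two arcs; $\phi(X)$ is a meandering tree if this graph is a tree (the diagram is always non-crossing). -}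

module Defs where

open import Data.Nat using (ℕ; zero; suc; _+_; _*_; _∸_; _≤_; _<_; _⊓_; _⊔_)
open import Data.List using (List; []; _∷_; _++_; [_]; map; upTo; length)
open import Data.List.Relation.Unary.All using (All)
open import Data.List.Relation.Unary.Any using (Any)
open import Data.List.Relation.Binary.Subset.Propositional using (_⊆_)
open import Data.Product using (_×_; _,_; proj₁; proj₂; ∃; ∃-syntax; Σ)
open import Data.Sum using (_⊎_)
open import Data.Fin using (Fin; toℕ) renaming (suc to fsuc; zero to fzero)
open import Data.Fin using (fromℕ<)
open import Data.Nat.DivMod using (m%n<n)
open import Function.Definitions using (Injective)
open import Relation.Binary.PropositionalEquality using (_≡_)
open import Relation.Binary.Construct.Closure.ReflexiveTransitive using (Star)
open import Relation.Nullary using (¬_)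

data BT : Set where
  leaf : BT
  node : BT → BT → BT

size : BT → ℕ
size leaf       = 0
size (node l r) = suc (size l + size r)

-- Infix order.  For the t-th node v_t (t = 1..n) in infix order,
-- bSeq lists b_t (size of left subtree), aSeq lists a_t (size of right subtree).

bSeq : BT → List ℕ
bSeq leaf       = []
bSeq (node l r) = bSeq l ++ (size l ∷ bSeq r)

aSeq : BT → List ℕ
aSeq leaf       = []
aSeq (node l r) = aSeq l ++ (size r ∷ aSeq r)

-- 0-indexed lookup with default 0 (only used for indices in range)
nth : List ℕ → ℕ → ℕ
nth []       _       = 0
nth (x ∷ xs) zero    = x
nth (x ∷ xs) (suc i) = nth xs i

a : BT → ℕ → ℕ
a T t = nth (aSeq T) (t ∸ 1)

b : BT → ℕ → ℕ
b T t = nth (bSeq T) (t ∸ 1)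

-- ι(T): the blocks (label sets) of the maximal right branches.
-- 'spine off t' for a subtree t whose nodes carry labels off+1 .. off+size t
-- returns (the right branch starting at the root of t, all other blocks).

mutual
  spine : ℕ → BT → List ℕ × List (List ℕ)
  spine off leaf       = [] , []
  spine off (node l r) =
    let k = off + size l + 1
    in (k ∷ proj₁ (spine k r)) , (blocks off l ++ proj₂ (spine k r))

  blocks : ℕ → BT → List (List ℕ)
  blocks off leaf         = []
  blocks off t@(node _ _) = proj₁ (spine off t) ∷ proj₂ (spine off t)

ι : BT → List (List ℕ)
ι T = blocks 0 T

_≼_ : List (List ℕ) → List (List ℕ) → Set
P ≼ Q = All (λ B → Any (λ B' → B ⊆ B') Q) P

Kreweras : BT → BT → Set
Kreweras T T' = ι T ≼ ι T'

-- All coordinates are DOUBLED so that they are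
-- natural numbers: the point x ∈ {0, 1/2, ..., n} is represented by 2x.
-- Black points = even numbers 0,2,..,2n; white points = odd numbers.

upperArc : BT → ℕ → ℕ × ℕ
upperArc T' t = (2 * t ∸ 1) , 2 * (t ∸ 1 ∸ b T' t)

lowerArc : BT → ℕ → ℕ × ℕ
lowerArc T t = (2 * t ∸ 1) , 2 * (t + a T t)

leftEnd rightEnd : ℕ × ℕ → ℕ
leftEnd  (x , y) = x ⊓ y
rightEnd (x , y) = x ⊔ y

-- Underlying (multi)graph: vertices = black points 0..n (undoubled),
-- one edge for each white point t - 1/2 (t = 1..n), joining the black
-- ends of its upper and lower arcs: t-1-b_t(T') and t+a_t(T).
-- The edge list is indexed by position (so parallel edges are allowed).

Edges : Set
Edges = List (ℕ × ℕ)

underlyingEdges : ℕ → BT → BT → Edges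
underlyingEdges n T T' =
  map (λ i → ((suc i ∸ 1 ∸ b T' (suc i)) , (suc i + a T (suc i)))) (upTo n)

edge : (E : Edges) → Fin (length E) → ℕ × ℕ
edge (e ∷ E) fzero    = e
edge (e ∷ E) (fsuc i) = edge E i

Joins : (E : Edges) → Fin (length E) → ℕ → ℕ → Set
Joins E e x y = (edge E e ≡ (x , y)) ⊎ (edge E e ≡ (y , x))

Adj : Edges → ℕ → ℕ → Set
Adj E x y = ∃[ e ] Joins E e x y

Connected : ℕ → Edges → Set
Connected n E = ∀ u v → u ≤ n → v ≤ n → Star (Adj E) u v

next : ∀ {k} → Fin (suc k) → Fin (suc k)
next {k} i = fromℕ< (m%n<n (suc (toℕ i)) (suc k))

record Cycle (E : Edges) : Set where
  field
    k   : ℕ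
    vs  : Fin (suc k) → ℕ
    es  : Fin (suc k) → Fin (length E)
    vs-inj : Injective _≡_ _≡_ vs
    es-inj : Injective _≡_ _≡_ es
    joins  : ∀ i → Joins E (es i) (vs i) (vs (next i))

Acyclic : Edges → Set
Acyclic E = ¬ Cycle E

IsTree : ℕ → Edges → Set
IsTree n E = Connected n E × Acyclic E

MeanderingTree : ℕ → BT → BT → Set
MeanderingTree n T T' = IsTree n (underlyingEdges n T T')

NonKrewerasPair : ℕ → BT → BT → Set
NonKrewerasPair n T T' =
  Σ ℕ λ s → Σ ℕ λ t → 1 ≤ s × s ≤ n × 1 ≤ t × t ≤ n ×
    (let lo = lowerArc T s ; up = upperArc T' t in
      leftEnd lo < leftEnd up × leftEnd up < rightEnd lo × rightEnd lo < rightEnd up)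

-- Number the nodes of a tree X by their 0-based infix position p (label p + 1).
-- The subtree of p occupies the positions [p − b, p + 1 + a), where a and b are the
-- sizes of its right and left subtrees, and these two end points are exactly the
-- black ends of the lower arc (in T) and the upper arc (in T') at p + 1/2.
-- Positions on a common right branch are those with a common subtree end, so
-- (T, T') is a Kreweras interval iff equal ends in T force equal ends in T'.
-- By laminarity of subtrees this is equivalent to: every subtree of T ends no
-- later than the corresponding subtree of T', and no lower arc of T interleaves
-- with an upper arc of T' as in a non-Kreweras pair.  The pointwise inequality is
-- exactly what makes the graph a tree.  If it holds, the root K of any subtree of
-- T' carries the only edge joining the part ≤ K of its range to the part > K, so
-- by induction over T' the graph is connected and no cycle exists (a cycle cannot
-- cross that cut just once).  Conversely, if p is the last position whose subtree
-- ends later in T than in T', no edge enters or leaves the window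
-- (p, end of p in T'], which disconnects p + 1 from 0.

module Submission where

open import Defs
open import Data.Nat using (ℕ; zero; suc; _+_; _*_; _∸_; _≤_; _<_; z≤n; s≤s; z<s)
open import Data.Nat.Properties
open import Data.Nat.DivMod using (m%n<n; m≤n⇒m%n≡m; n%n≡0)
open import Data.Fin using (Fin; toℕ; fromℕ<) renaming (zero to fzero; suc to fsuc)
open import Data.Fin.Properties using (toℕ-fromℕ<; toℕ-injective; toℕ<n)
open import Data.List using (List; []; _∷_; _++_; map; applyUpTo; length)
open import Data.List.Properties using (length-++; length-map; length-applyUpTo)
open import Data.List.Membership.Propositional using (_∈_; find; lose)
import Data.List.Relation.Unary.All as All
open import Data.List.Relation.Unary.Any using (Any; here; there)
open import Data.List.Relation.Unary.Any.Properties using (++⁺ˡ; ++⁺ʳ; ++⁻)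
open import Data.List.Relation.Binary.Subset.Propositional using (_⊆_)
open import Data.Product using (_×_; _,_; proj₁; proj₂; ∃-syntax; Σ)
open import Data.Sum using (_⊎_; inj₁; inj₂; [_,_]′)
open import Data.Empty using (⊥-elim)
open import Function.Base using (_∘_)
open import Function.Bundles using (_⇔_; mk⇔; Equivalence)
open import Function.Construct.Identity using (⇔-id)
open import Function.Construct.Symmetry using (⇔-sym)
open import Function.Construct.Composition using (_⇔-∘_)
open import Relation.Binary.PropositionalEquality
open import Relation.Binary.Definitions using (tri<; tri≈; tri>)
open import Relation.Binary.Construct.Closure.ReflexiveTransitive using (Star; ε; _◅_; _◅◅_)
open import Relation.Nullary using (¬_; yes; no; contradiction)

private
  <-≤-absurd : ∀ {m n} {A : Set} → n < m → m ≤ n → A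
  <-≤-absurd n<m m≤n = contradiction m≤n (<⇒≱ n<m)

-- The subtree at position p (label p + 1) occupies the positions [subtreeStart X p , subtreeEnd X p).

rightSize leftSize subtreeEnd subtreeStart : BT → ℕ → ℕ
rightSize    X p = nth (aSeq X) p
leftSize     X p = nth (bSeq X) p
subtreeEnd   X p = suc p + rightSize X p
subtreeStart X p = p ∸ leftSize X p

length-aSeq : ∀ X → length (aSeq X) ≡ size X
length-aSeq leaf       = refl
length-aSeq (node l r) = begin
  length (aSeq l ++ size r ∷ aSeq r)     ≡⟨ length-++ (aSeq l) ⟩
  length (aSeq l) + suc (length (aSeq r)) ≡⟨ cong₂ (λ x y → x + suc y) (length-aSeq l) (length-aSeq r) ⟩
  size l + suc (size r)                   ≡⟨ +-suc (size l) (size r) ⟩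
  suc (size l + size r)                   ∎
  where open ≡-Reasoning

length-bSeq : ∀ X → length (bSeq X) ≡ size X
length-bSeq leaf       = refl
length-bSeq (node l r) = begin
  length (bSeq l ++ size l ∷ bSeq r)     ≡⟨ length-++ (bSeq l) ⟩
  length (bSeq l) + suc (length (bSeq r)) ≡⟨ cong₂ (λ x y → x + suc y) (length-bSeq l) (length-bSeq r) ⟩
  size l + suc (size r)                   ≡⟨ +-suc (size l) (size r) ⟩
  suc (size l + size r)                   ∎
  where open ≡-Reasoning

nth-++ˡ : ∀ xs ys {p} → p < length xs → nth (xs ++ ys) p ≡ nth xs p
nth-++ˡ (x ∷ xs) ys {zero}  _         = refl
nth-++ˡ (x ∷ xs) ys {suc p} (s≤s p<n) = nth-++ˡ xs ys p<n

nth-++ʳ : ∀ xs ys {L} q → length xs ≡ L → nth (xs ++ ys) (L + q) ≡ nth ys q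
nth-++ʳ []       ys q refl = refl
nth-++ʳ (x ∷ xs) ys q refl = nth-++ʳ xs ys q refl

nth-++-length : ∀ xs y ys {L} → length xs ≡ L → nth (xs ++ y ∷ ys) L ≡ y
nth-++-length []       y ys refl = refl
nth-++-length (x ∷ xs) y ys refl = nth-++-length xs y ys refl

data Position (L R : ℕ) : ℕ → Set where
  left  : ∀ {p} → p < L → Position L R p
  root  : Position L R L
  right : ∀ {q} → q < R → Position L R (L + suc q)

position : ∀ L R {p} → p < suc (L + R) → Position L R p
position zero    R {zero}  _         = root
position zero    R {suc q} (s≤s q<R) = right q<R
position (suc L) R {zero}  _         = left (s≤s z≤n)
position (suc L) R {suc p} (s≤s p<n) with position L R p<n
... | left p<L  = left (s≤s p<L)
... | root      = root
... | right q<R = right q<R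

module _ (l r : BT) where

  rightSize-left : ∀ {p} → p < size l → rightSize (node l r) p ≡ rightSize l p
  rightSize-left p<L = nth-++ˡ (aSeq l) _ (subst (_ <_) (sym (length-aSeq l)) p<L)

  rightSize-right : ∀ q → rightSize (node l r) (size l + suc q) ≡ rightSize r q
  rightSize-right q = nth-++ʳ (aSeq l) _ (suc q) (length-aSeq l)

  leftSize-left : ∀ {p} → p < size l → leftSize (node l r) p ≡ leftSize l p
  leftSize-left p<L = nth-++ˡ (bSeq l) _ (subst (_ <_) (sym (length-bSeq l)) p<L)

  leftSize-right : ∀ q → leftSize (node l r) (size l + suc q) ≡ leftSize r q
  leftSize-right q = nth-++ʳ (bSeq l) _ (suc q) (length-bSeq l)

  subtreeEnd-left : ∀ {p} → p < size l → subtreeEnd (node l r) p ≡ subtreeEnd l p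
  subtreeEnd-left {p} p<L = cong (suc p +_) (rightSize-left p<L)

  subtreeEnd-root : subtreeEnd (node l r) (size l) ≡ size (node l r)
  subtreeEnd-root = cong (suc (size l) +_) (nth-++-length (aSeq l) _ _ (length-aSeq l))

  subtreeEnd-right : ∀ q → subtreeEnd (node l r) (size l + suc q) ≡ suc (size l) + subtreeEnd r q
  subtreeEnd-right q = begin
    suc (size l + suc q) + rightSize (node l r) (size l + suc q) ≡⟨ cong (suc (size l + suc q) +_) (rightSize-right q) ⟩
    suc (size l + suc q) + rightSize r q                          ≡⟨ cong suc (+-assoc (size l) (suc q) _) ⟩
    suc (size l) + subtreeEnd r q                                 ∎
    where open ≡-Reasoning

  subtreeStart-left : ∀ {p} → p < size l → subtreeStart (node l r) p ≡ subtreeStart l p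
  subtreeStart-left {p} p<L = cong (p ∸_) (leftSize-left p<L)

  subtreeStart-root : subtreeStart (node l r) (size l) ≡ 0
  subtreeStart-root = trans (cong (size l ∸_) (nth-++-length (bSeq l) _ _ (length-bSeq l))) (n∸n≡0 (size l))

p<subtreeEnd : ∀ X p → p < subtreeEnd X p
p<subtreeEnd X p = s≤s (m≤m+n p (rightSize X p))

subtreeStart≤ : ∀ X p → subtreeStart X p ≤ p
subtreeStart≤ X p = m∸n≤m p (leftSize X p)

left<node : ∀ l r → size l < size (node l r)
left<node l r = s≤s (m≤m+n (size l) (size r))

right<node : ∀ l r {q} → q < size r → size l + suc q < size (node l r)
right<node l r q<R = s≤s (+-monoʳ-≤ (size l) q<R)

subtreeEnd≤size : ∀ X p → p < size X → subtreeEnd X p ≤ size X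
subtreeEnd≤size leaf       p ()
subtreeEnd≤size (node l r) p p<n with position (size l) (size r) p<n
... | left p<L  = begin
  subtreeEnd (node l r) p ≡⟨ subtreeEnd-left l r p<L ⟩
  subtreeEnd l p          ≤⟨ subtreeEnd≤size l p p<L ⟩
  size l                  <⟨ left<node l r ⟩
  size (node l r)         ∎
  where open ≤-Reasoning
... | root      = ≤-reflexive (subtreeEnd-root l r)
... | right {q} q<R = begin
  subtreeEnd (node l r) (size l + suc q) ≡⟨ subtreeEnd-right l r q ⟩
  suc (size l) + subtreeEnd r q          ≤⟨ +-monoʳ-≤ (suc (size l)) (subtreeEnd≤size r q q<R) ⟩
  suc (size l) + size r                  ∎
  where open ≤-Reasoning

leftSize≤ : ∀ X p → p < size X → leftSize X p ≤ p
leftSize≤ leaf       p ()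
leftSize≤ (node l r) p p<n with position (size l) (size r) p<n
... | left p<L      = subst (_≤ p) (sym (leftSize-left l r p<L)) (leftSize≤ l p p<L)
... | root          = ≤-reflexive (nth-++-length (bSeq l) _ _ (length-bSeq l))
... | right {q} q<R = subst (_≤ size l + suc q) (sym (leftSize-right l r q))
                        (≤-trans (leftSize≤ r q q<R) (≤-trans (n≤1+n q) (m≤n+m (suc q) (size l))))

subtreeStart-right : ∀ l r {q} → q < size r → subtreeStart (node l r) (size l + suc q) ≡ suc (size l) + subtreeStart r q
subtreeStart-right l r {q} q<R = begin
  size l + suc q ∸ leftSize (node l r) (size l + suc q) ≡⟨ cong₂ _∸_ (+-suc (size l) q) (leftSize-right l r q) ⟩
  suc (size l) + q ∸ leftSize r q                       ≡⟨ +-∸-assoc (suc (size l)) (leftSize≤ r q q<R) ⟩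
  suc (size l) + subtreeStart r q                       ∎
  where open ≡-Reasoning

subtreeEnd-left≤ : ∀ l r {p} → p < size l → subtreeEnd (node l r) p ≤ size l
subtreeEnd-left≤ l r {p} p<L = subst (_≤ size l) (sym (subtreeEnd-left l r p<L)) (subtreeEnd≤size l p p<L)

right-descendant-nested : ∀ X q p → p < size X → q < p → p < subtreeEnd X q →
                          subtreeEnd X p ≤ subtreeEnd X q × q < subtreeStart X p
right-descendant-nested leaf q p () _ _
right-descendant-nested (node l r) q p p<n q<p p<end
  with position (size l) (size r) (<-trans q<p p<n) | position (size l) (size r) p<n
... | left q<L | left p<L
  rewrite subtreeEnd-left l r q<L | subtreeEnd-left l r p<L | subtreeStart-left l r p<L
  = right-descendant-nested l q p p<L q<p p<end
... | left q<L | root      = <-≤-absurd p<end (subtreeEnd-left≤ l r q<L)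
... | left q<L | right _   = <-≤-absurd (≤-<-trans (m≤m+n (size l) _) p<end) (subtreeEnd-left≤ l r q<L)
... | root     | left p<L  = <-≤-absurd q<p (<⇒≤ p<L)
... | root     | root      = <-≤-absurd q<p ≤-refl
... | root     | right {p} p<R
  rewrite subtreeEnd-right l r p | subtreeEnd-root l r | subtreeStart-right l r p<R
  = +-monoʳ-≤ (suc (size l)) (subtreeEnd≤size r p p<R) , s≤s (m≤m+n (size l) _)
... | right _  | left p<L  = <-≤-absurd q<p (≤-trans (<⇒≤ p<L) (m≤m+n (size l) _))
... | right _  | root      = <-≤-absurd q<p (m≤m+n (size l) _)
... | right {q} q<R | right {p} p<R
  rewrite subtreeEnd-right l r p | subtreeEnd-right l r q | subtreeStart-right l r p<R
  with right-descendant-nested r q p p<R (≤-pred (+-cancelˡ-< (size l) _ _ q<p))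
         (+-cancelˡ-≤ (suc (size l)) _ _ p<end)
... | end≤end , q<start = +-monoʳ-≤ (suc (size l)) end≤end
                        , subst (_< suc (size l) + subtreeStart r p) (sym (+-suc (size l) q))
                                (+-monoʳ-< (suc (size l)) q<start)

left-descendant-ends-before : ∀ X q p → p < size X → q < p → subtreeStart X p ≤ q → subtreeEnd X q ≤ p
left-descendant-ends-before leaf q p () _ _
left-descendant-ends-before (node l r) q p p<n q<p start≤q
  with position (size l) (size r) (<-trans q<p p<n) | position (size l) (size r) p<n
... | left q<L | left p<L
  rewrite subtreeEnd-left l r q<L | subtreeStart-left l r p<L
  = left-descendant-ends-before l q p p<L q<p start≤q
... | left q<L | root      = subtreeEnd-left≤ l r q<L
... | left q<L | right _   = ≤-trans (subtreeEnd-left≤ l r q<L) (m≤m+n (size l) _)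
... | root     | left p<L  = <-≤-absurd q<p (<⇒≤ p<L)
... | root     | root      = <-≤-absurd q<p ≤-refl
... | root     | right p<R
  rewrite subtreeStart-right l r p<R = <-≤-absurd (s≤s (m≤m+n (size l) _)) start≤q
... | right _  | left p<L  = <-≤-absurd q<p (≤-trans (<⇒≤ p<L) (m≤m+n (size l) _))
... | right _  | root      = <-≤-absurd q<p (m≤m+n (size l) _)
... | right {q} q<R | right {p} p<R
  rewrite subtreeStart-right l r p<R | subtreeEnd-right l r q
  = begin
    suc (size l) + subtreeEnd r q ≤⟨ +-monoʳ-≤ (suc (size l)) end≤p ⟩
    suc (size l) + p              ≡⟨ +-suc (size l) p ⟨
    size l + suc p                ∎
  where
  open ≤-Reasoning
  end≤p : subtreeEnd r q ≤ p
  end≤p = left-descendant-ends-before r q p p<R (≤-pred (+-cancelˡ-< (size l) _ _ q<p))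
            (+-cancelˡ-≤ (suc (size l)) _ _ (≤-trans start≤q (≤-reflexive (+-suc (size l) q))))

subtreeStart≡suc⇒descendant : ∀ X q u → q < size X → subtreeStart X q ≡ suc u → q < subtreeEnd X u
subtreeStart≡suc⇒descendant leaf q u () _
subtreeStart≡suc⇒descendant (node l r) q u q<n start≡1+u with position (size l) (size r) q<n
... | left q<L rewrite subtreeStart-left l r q<L =
  subst (q <_) (sym (subtreeEnd-left l r u<L)) (subtreeStart≡suc⇒descendant l q u q<L start≡1+u)
  where
  u<L : u < size l
  u<L = ≤-<-trans (≤-trans (n≤1+n u) (≤-trans (≤-reflexive (sym start≡1+u)) (subtreeStart≤ l q))) q<L
... | root rewrite subtreeStart-root l r = contradiction start≡1+u λ ()
... | right {q} q<R rewrite subtreeStart-right l r q<R with subtreeStart r q in start-r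
...   | zero  = subst (λ u → size l + suc q < subtreeEnd (node l r) u) L≡u
                  (subst (size l + suc q <_) (sym (subtreeEnd-root l r)) (right<node l r q<R))
  where
  L≡u : size l ≡ u
  L≡u = trans (sym (+-identityʳ (size l))) (suc-injective start≡1+u)
...   | suc v = subst (λ u → size l + suc q < subtreeEnd (node l r) u) (suc-injective start≡1+u) (begin-strict
  size l + suc q                         ≡⟨ +-suc (size l) q ⟩
  suc (size l) + q                       <⟨ +-monoʳ-< (suc (size l)) (subtreeStart≡suc⇒descendant r q v q<R start-r) ⟩
  suc (size l) + subtreeEnd r v          ≡⟨ subtreeEnd-right l r v ⟨
  subtreeEnd (node l r) (size l + suc v) ∎)
  where open ≤-Reasoning

subtreeStart-subtreeEnd≤ : ∀ X p → p < size X → subtreeEnd X p < size X →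
                           subtreeStart X (subtreeEnd X p) ≤ subtreeStart X p
subtreeStart-subtreeEnd≤ leaf p () _
subtreeStart-subtreeEnd≤ (node l r) p p<n end<n with position (size l) (size r) p<n
... | left p<L with m≤n⇒m<n∨m≡n (subtreeEnd≤size l p p<L)
...   | inj₁ end<L = begin
  subtreeStart (node l r) (subtreeEnd (node l r) p) ≡⟨ cong (subtreeStart (node l r)) (subtreeEnd-left l r p<L) ⟩
  subtreeStart (node l r) (subtreeEnd l p)          ≡⟨ subtreeStart-left l r end<L ⟩
  subtreeStart l (subtreeEnd l p)                   ≤⟨ subtreeStart-subtreeEnd≤ l p p<L end<L ⟩
  subtreeStart l p                                  ≡⟨ subtreeStart-left l r p<L ⟨
  subtreeStart (node l r) p                         ∎
  where open ≤-Reasoning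
...   | inj₂ end≡L = subst (_≤ subtreeStart (node l r) p)
          (sym (trans (cong (subtreeStart (node l r)) (trans (subtreeEnd-left l r p<L) end≡L)) (subtreeStart-root l r)))
          z≤n
subtreeStart-subtreeEnd≤ (node l r) p p<n end<n | root = <-≤-absurd end<n (≤-reflexive (sym (subtreeEnd-root l r)))
subtreeStart-subtreeEnd≤ (node l r) .(size l + suc q) p<n end<n | right {q} q<R = begin
  subtreeStart (node l r) (subtreeEnd (node l r) (size l + suc q)) ≡⟨ cong (subtreeStart (node l r)) end≡ ⟩
  subtreeStart (node l r) (size l + suc (subtreeEnd r q))          ≡⟨ subtreeStart-right l r end-r<R ⟩
  suc (size l) + subtreeStart r (subtreeEnd r q)                   ≤⟨ +-monoʳ-≤ (suc (size l)) (subtreeStart-subtreeEnd≤ r q q<R end-r<R) ⟩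
  suc (size l) + subtreeStart r q                                  ≡⟨ subtreeStart-right l r q<R ⟨
  subtreeStart (node l r) (size l + suc q)                         ∎
  where
  open ≤-Reasoning
  end≡ : subtreeEnd (node l r) (size l + suc q) ≡ size l + suc (subtreeEnd r q)
  end≡ = trans (subtreeEnd-right l r q) (sym (+-suc (size l) _))
  end-r<R : subtreeEnd r q < size r
  end-r<R = +-cancelˡ-≤ (size l) _ _ (≤-pred (subst (_< size (node l r)) end≡ end<n))

subtreeEnd-last : ∀ X p → p < size X → subtreeEnd X (p + rightSize X p) ≡ subtreeEnd X p
subtreeEnd-last X p p<n with m≤n⇒m<n∨m≡n (m≤m+n p (rightSize X p))
... | inj₂ p≡last = cong (subtreeEnd X) (sym p≡last)
... | inj₁ p<last = ≤-antisym
  (proj₁ (right-descendant-nested X p (p + rightSize X p) (subtreeEnd≤size X p p<n) p<last ≤-refl))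
  (p<subtreeEnd X (p + rightSize X p))

subtreeStart-inside⇒descendant : ∀ X p t → t < size X → p < subtreeStart X t → subtreeStart X t ≤ subtreeEnd X p →
                                 t < subtreeEnd X p
subtreeStart-inside⇒descendant X p t t<n p<start start≤end with subtreeStart X t in start≡
... | suc u with m≤n⇒m<n∨m≡n (≤-pred p<start)
...   | inj₂ refl = subtreeStart≡suc⇒descendant X t p t<n start≡
...   | inj₁ p<u  = begin-strict
  t              <⟨ subtreeStart≡suc⇒descendant X t u t<n start≡ ⟩
  subtreeEnd X u ≤⟨ proj₁ (right-descendant-nested X p u u<n p<u start≤end) ⟩
  subtreeEnd X p ∎
  where
  open ≤-Reasoning
  u<n : u < size X
  u<n = <-≤-trans (n<1+n u) (≤-trans (≤-reflexive (sym start≡)) (≤-trans (subtreeStart≤ X t) (<⇒≤ t<n)))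

-- With labels shifted by off, the blocks of ι X are the classes of positions with a
-- common subtree end.

record EndClass (X : BT) (off : ℕ) (B : List ℕ) : Set where
  field
    value    : ℕ
    sound    : ∀ {y} → y ∈ B → ∃[ p ] y ≡ off + suc p × p < size X × subtreeEnd X p ≡ value
    complete : ∀ {p} → p < size X → subtreeEnd X p ≡ value → off + suc p ∈ B
    inhabited : ∃[ y ] y ∈ B

  member-end : ∀ {p} → off + suc p ∈ B → subtreeEnd X p ≡ value
  member-end m with sound m
  ... | _ , label≡ , _ , end≡ = trans (cong (subtreeEnd X) (suc-injective (+-cancelˡ-≡ off _ _ label≡))) end≡

  value≤size : value ≤ size X
  value≤size with inhabited
  ... | _ , m with sound m
  ... | p , _ , p<n , end≡ = subst (_≤ size X) end≡ (subtreeEnd≤size X p p<n)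

open EndClass

label-root : ∀ off L → off + L + 1 ≡ off + suc L
label-root off L = trans (+-assoc off L 1) (cong (off +_) (+-comm L 1))

label-right : ∀ off L q → off + L + 1 + suc q ≡ off + suc (L + suc q)
label-right off L q = trans (cong (_+ suc q) (label-root off L)) (+-assoc off (suc L) (suc q))

offset-right : ∀ off L q → off + suc L + q ≡ off + (L + suc q)
offset-right off L q = trans (+-assoc off (suc L) q) (cong (off +_) (sym (+-suc L q)))

spine-sound : ∀ X off {y} → y ∈ proj₁ (spine off X) → ∃[ p ] y ≡ off + suc p × p < size X × subtreeEnd X p ≡ size X
spine-sound leaf       off ()
spine-sound (node l r) off (here refl) =
  size l , label-root off (size l) , left<node l r , subtreeEnd-root l r
spine-sound (node l r) off (there m) with spine-sound r (off + size l + 1) m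
... | q , refl , q<R , end≡ =
  size l + suc q , label-right off (size l) q , right<node l r q<R ,
  trans (subtreeEnd-right l r q) (cong (suc (size l) +_) end≡)

spine-complete : ∀ X off {p} → p < size X → subtreeEnd X p ≡ size X → off + suc p ∈ proj₁ (spine off X)
spine-complete leaf       off ()
spine-complete (node l r) off p<n end≡ with position (size l) (size r) p<n
... | left p<L      = <-≤-absurd (subst (size l <_) (sym end≡) (left<node l r)) (subtreeEnd-left≤ l r p<L)
... | root          = here (sym (label-root off (size l)))
... | right {q} q<R = there (subst (_∈ proj₁ (spine (off + size l + 1) r)) (label-right off (size l) q)
                        (spine-complete r (off + size l + 1) q<R
                          (+-cancelˡ-≡ (suc (size l)) _ _ (trans (sym (subtreeEnd-right l r q)) end≡))))

spine-endClass : ∀ l r off → EndClass (node l r) off (proj₁ (spine off (node l r)))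
spine-endClass l r off = record
  { value     = size (node l r)
  ; sound     = spine-sound (node l r) off
  ; complete  = spine-complete (node l r) off
  ; inhabited = _ , here refl
  }

endClass-left : ∀ {l off B} r → EndClass l off B → EndClass (node l r) off B
endClass-left {l} {off} {B} r C = record
  { value     = value C
  ; sound     = sound′
  ; complete  = complete′
  ; inhabited = inhabited C
  }
  where
  sound′ : ∀ {y} → y ∈ B → ∃[ p ] y ≡ off + suc p × p < size (node l r) × subtreeEnd (node l r) p ≡ value C
  sound′ m with sound C m
  ... | p , label≡ , p<L , end≡ = p , label≡ , <-trans p<L (left<node l r) , trans (subtreeEnd-left l r p<L) end≡

  complete′ : ∀ {p} → p < size (node l r) → subtreeEnd (node l r) p ≡ value C → off + suc p ∈ B
  complete′ p<n end≡ with position (size l) (size r) p<n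
  ... | left p<L = complete C p<L (trans (sym (subtreeEnd-left l r p<L)) end≡)
  ... | root     = <-≤-absurd (left<node l r)
                     (≤-trans (≤-reflexive (trans (sym (subtreeEnd-root l r)) end≡)) (value≤size C))
  ... | right {q} _ = <-≤-absurd (≤-<-trans (m≤m+n (size l) (suc q)) (p<subtreeEnd (node l r) (size l + suc q)))
                        (≤-trans (≤-reflexive end≡) (value≤size C))

endClass-right : ∀ {r B} l off (C : EndClass r (off + size l + 1) B) → value C ≢ size r → EndClass (node l r) off B
endClass-right {r} {B} l off C value≢size = record
  { value     = suc (size l) + value C
  ; sound     = sound′
  ; complete  = complete′
  ; inhabited = inhabited C
  }
  where
  sound′ : ∀ {y} → y ∈ B → ∃[ p ] y ≡ off + suc p × p < size (node l r) × subtreeEnd (node l r) p ≡ suc (size l) + value C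
  sound′ m with sound C m
  ... | q , label≡ , q<R , end≡ = size l + suc q , trans label≡ (label-right off (size l) q) , right<node l r q<R ,
                                 trans (subtreeEnd-right l r q) (cong (suc (size l) +_) end≡)

  complete′ : ∀ {p} → p < size (node l r) → subtreeEnd (node l r) p ≡ suc (size l) + value C → off + suc p ∈ B
  complete′ p<n end≡ with position (size l) (size r) p<n
  ... | left p<L      = <-≤-absurd (≤-trans (m≤m+n (suc (size l)) (value C)) (≤-reflexive (sym end≡)))
                          (subtreeEnd-left≤ l r p<L)
  ... | root          = contradiction (+-cancelˡ-≡ (suc (size l)) _ _ (trans (sym end≡) (subtreeEnd-root l r))) value≢size
  ... | right {q} q<R = subst (_∈ B) (label-right off (size l) q)
                          (complete C q<R (+-cancelˡ-≡ (suc (size l)) _ _ (trans (sym (subtreeEnd-right l r q)) end≡)))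

mutual
  blocks-endClass : ∀ X off {B} → B ∈ blocks off X → EndClass X off B
  blocks-endClass leaf       off ()
  blocks-endClass (node l r) off (here refl) = spine-endClass l r off
  blocks-endClass (node l r) off (there m)   = proj₁ (offSpine-endClass (node l r) off m)

  offSpine-endClass : ∀ X off {B} → B ∈ proj₂ (spine off X) → Σ (EndClass X off B) (λ C → value C ≢ size X)
  offSpine-endClass leaf       off ()
  offSpine-endClass (node l r) off m with ++⁻ (blocks off l) m
  ... | inj₁ m-l = endClass-left r C ,
                   λ value≡ → <-≤-absurd (left<node l r) (≤-trans (≤-reflexive (sym value≡)) (value≤size C))
    where
    C : EndClass l off _
    C = blocks-endClass l off m-l
  ... | inj₂ m-r with offSpine-endClass r (off + size l + 1) m-r
  ...   | C , value≢size = endClass-right l off C value≢size ,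
                           λ value≡ → value≢size (+-cancelˡ-≡ (suc (size l)) _ _ value≡)

mutual
  blocks-cover : ∀ X off {p} → p < size X → Any (off + suc p ∈_) (blocks off X)
  blocks-cover leaf       off ()
  blocks-cover (node l r) off {p} p<n with subtreeEnd (node l r) p ≟ size (node l r)
  ... | yes end≡ = here (spine-complete (node l r) off p<n end≡)
  ... | no  end≢ = there (offSpine-cover-node l r off p<n end≢)

  offSpine-cover : ∀ X off {p} → p < size X → subtreeEnd X p ≢ size X → Any (off + suc p ∈_) (proj₂ (spine off X))
  offSpine-cover leaf       off ()
  offSpine-cover (node l r) off = offSpine-cover-node l r off

  offSpine-cover-node : ∀ l r off {p} → p < size (node l r) → subtreeEnd (node l r) p ≢ size (node l r) →
                        Any (off + suc p ∈_) (proj₂ (spine off (node l r)))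
  offSpine-cover-node l r off p<n end≢ with position (size l) (size r) p<n
  ... | left p<L      = ++⁺ˡ (blocks-cover l off p<L)
  ... | root          = contradiction (subtreeEnd-root l r) end≢
  ... | right {q} q<R = ++⁺ʳ (blocks off l)
    (subst (λ y → Any (y ∈_) (proj₂ (spine (off + size l + 1) r))) (label-right off (size l) q)
      (offSpine-cover r (off + size l + 1) q<R
        (λ end≡ → end≢ (trans (subtreeEnd-right l r q) (cong (suc (size l) +_) end≡)))))

EndRefines : BT → BT → Set
EndRefines T T' = ∀ {p q} → p < size T → q < size T →
                  subtreeEnd T p ≡ subtreeEnd T q → subtreeEnd T' p ≡ subtreeEnd T' q

Kreweras⇒endRefines : ∀ {T T'} → Kreweras T T' → EndRefines T T'
Kreweras⇒endRefines {T} {T'} kre {p} {q} p<n q<n end≡ with find (blocks-cover T 0 p<n)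
... | B , B∈ιT , p∈B with find (All.lookup kre B∈ιT)
... | B' , B'∈ιT' , B⊆B' = trans (member-end C' (B⊆B' p∈B)) (sym (member-end C' (B⊆B' q∈B)))
  where
  C : EndClass T 0 B
  C = blocks-endClass T 0 B∈ιT
  C' : EndClass T' 0 B'
  C' = blocks-endClass T' 0 B'∈ιT'
  q∈B : suc q ∈ B
  q∈B = complete C q<n (trans (sym end≡) (member-end C p∈B))

endRefines⇒Kreweras : ∀ {T T'} → size T ≡ size T' → EndRefines T T' → Kreweras T T'
endRefines⇒Kreweras {T} {T'} |T|≡|T'| refines = All.tabulate (classInBlock ∘ blocks-endClass T 0)
  where
  toT' : ∀ {p} → p < size T → p < size T'
  toT' = subst (_ <_) |T|≡|T'|

  classInBlock : ∀ {B} → EndClass T 0 B → Any (B ⊆_) (ι T')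
  classInBlock {B} C with inhabited C
  ... | _ , y∈B with sound C y∈B
  ... | p₀ , refl , p₀<n , end₀≡ with find (blocks-cover T' 0 (toT' p₀<n))
  ... | B' , B'∈ιT' , p₀∈B' = lose B'∈ιT' B⊆B'
    where
    C' : EndClass T' 0 B'
    C' = blocks-endClass T' 0 B'∈ιT'
    B⊆B' : B ⊆ B'
    B⊆B' x∈B with sound C x∈B
    ... | p , refl , p<n , end≡ =
      complete C' (toT' p<n) (trans (refines p<n p₀<n (trans end≡ (sym end₀≡))) (member-end C' p₀∈B'))

module _ {E : Edges} (cycle : Cycle E) (P : ℕ → Set) where
  open Cycle cycle

  Preserves : Fin (suc k) → Set
  Preserves j = P (vs j) ⇔ P (vs (next j))

  private
    at : ℕ → Fin (suc k)
    at m = fromℕ< (m%n<n m (suc k))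

    V : ℕ → ℕ
    V m = vs (at m)

    toℕ-at : ∀ {m} → m ≤ k → toℕ (at m) ≡ m
    toℕ-at {m} m≤k = trans (toℕ-fromℕ< (m%n<n m (suc k))) (m≤n⇒m%n≡m m≤k)

    at-toℕ : ∀ i → at (toℕ i) ≡ i
    at-toℕ i = toℕ-injective (toℕ-at (≤-pred (toℕ<n i)))

    at-wrap : at (suc k) ≡ fzero
    at-wrap = toℕ-injective (trans (toℕ-fromℕ< (m%n<n (suc k) (suc k))) (n%n≡0 (suc k)))

    Step : ℕ → Set
    Step m = P (V m) ⇔ P (V (suc m))

    step : ∀ {m} → m ≤ k → Preserves (at m) → Step m
    step {m} m≤k = subst (λ t → P (V m) ⇔ P (vs (at (suc t)))) (toℕ-at m≤k)

    walk : ∀ a d → (∀ m → a ≤ m → m < a + d → Step m) → P (V a) ⇔ P (V (a + d))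
    walk a zero    _     = subst (λ x → P (V a) ⇔ P (V x)) (sym (+-identityʳ a)) (⇔-id _)
    walk a (suc d) steps = subst (λ x → P (V a) ⇔ P (V x)) (sym (+-suc a d))
      (steps (a + d) (m≤m+n a d) (+-monoʳ-< a ≤-refl)
        ⇔-∘ walk a d (λ m a≤m m<a+d → steps m a≤m (≤-trans m<a+d (+-monoʳ-≤ a (n≤1+n d)))))

  preserved-along-cycle : (∀ j → Preserves j) → ∀ j → P (vs fzero) ⇔ P (vs j)
  preserved-along-cycle preserves j = subst (λ v → P (vs fzero) ⇔ P v) (cong vs (at-toℕ j))
    (walk 0 (toℕ j) λ m _ m<j → step (≤-trans (<⇒≤ m<j) (≤-pred (toℕ<n j))) (preserves (at m)))

  -- A cycle cannot cross a cut exactly once.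
  preserved-at-remaining-edge : ∀ i → (∀ j → j ≢ i → Preserves j) → Preserves i
  preserved-at-remaining-edge i preserves = subst (λ v → P v ⇔ P (vs (next i))) (cong vs (at-toℕ i))
    (⇔-sym after ⇔-∘ (wrap ⇔-∘ ⇔-sym before))
    where
    c : ℕ
    c = toℕ i
    c≤k : c ≤ k
    c≤k = ≤-pred (toℕ<n i)

    stepAway : ∀ {m} → m ≤ k → m ≢ c → Step m
    stepAway {m} m≤k m≢c = step m≤k (preserves (at m) λ at≡i → m≢c (trans (sym (toℕ-at m≤k)) (cong toℕ at≡i)))

    before : P (V 0) ⇔ P (V c)
    before = walk 0 c λ m _ m<c → stepAway (≤-trans (<⇒≤ m<c) c≤k) (<⇒≢ m<c)

    after : P (V (suc c)) ⇔ P (V (suc k))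
    after = subst (λ x → P (V (suc c)) ⇔ P (V (suc x))) (m+[n∸m]≡n c≤k)
      (walk (suc c) (k ∸ c) λ m c<m m<end →
        stepAway (≤-pred (subst (m <_) (cong suc (m+[n∸m]≡n c≤k)) m<end)) (≢-sym (<⇒≢ c<m)))

    wrap : P (V 0) ⇔ P (V (suc k))
    wrap = subst (λ j → P (V 0) ⇔ P (vs j)) (sym at-wrap) (⇔-id _)

module _ (f : ℕ → ℕ × ℕ) where

  edge-map-applyUpTo : ∀ g m (e : Fin (length (map f (applyUpTo g m)))) → edge (map f (applyUpTo g m)) e ≡ f (g (toℕ e))
  edge-map-applyUpTo g (suc m) fzero    = refl
  edge-map-applyUpTo g (suc m) (fsuc e) = edge-map-applyUpTo (g ∘ suc) m e

  length-map-applyUpTo : ∀ g m → length (map f (applyUpTo g m)) ≡ m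
  length-map-applyUpTo g m = trans (length-map f (applyUpTo g m)) (length-applyUpTo g m)

  index-map-applyUpTo : ∀ g {m i} → i < m → ∃[ e ] toℕ {length (map f (applyUpTo g m))} e ≡ i
  index-map-applyUpTo g {suc m} {zero}  _         = fzero , refl
  index-map-applyUpTo g {suc m} {suc i} (s≤s i<m) with index-map-applyUpTo (g ∘ suc) i<m
  ... | e , toℕ-e≡i = fsuc e , cong suc toℕ-e≡i

downward-induction : ∀ {P : ℕ → Set} n → (∀ p → p < n → (∀ q → p < q → q < n → P q) → P p) → ∀ p → p < n → P p
downward-induction {P} n step p = go (n ∸ p) p ≤-refl
  where
  go : ∀ d p → n ∸ p ≤ d → p < n → P p
  go zero    p n∸p≤0 p<n = <-≤-absurd p<n (m∸n≡0⇒m≤n (n≤0⇒n≡0 n∸p≤0))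
  go (suc d) p n∸p≤1+d p<n = step p p<n λ q p<q q<n →
    go d q (≤-pred (<-≤-trans (∸-monoʳ-< p<q (<⇒≤ q<n)) n∸p≤1+d)) q<n

odd<double⇔ : ∀ {q y} → suc (2 * q) < 2 * y ⇔ q < y
odd<double⇔ {q} {y} = mk⇔
  (λ h → *-cancelˡ-≤ 2 (subst (_≤ 2 * y) (sym (*-suc 2 q)) h))
  (λ q<y → subst (_≤ 2 * y) (*-suc 2 q) (*-monoʳ-≤ 2 q<y))

double<double⇔ : ∀ {y x} → 2 * y < 2 * x ⇔ y < x
double<double⇔ {y} {x} = mk⇔ (*-cancelˡ-< 2 y x) (*-monoʳ-< 2)

double<odd⇔ : ∀ {x p} → 2 * x < suc (2 * p) ⇔ x ≤ p
double<odd⇔ = mk⇔ (*-cancelˡ-≤ 2 ∘ ≤-pred) (s≤s ∘ *-monoʳ-≤ 2)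

ArcsInterleave : ℕ × ℕ → ℕ × ℕ → Set
ArcsInterleave lower upper =
  leftEnd lower < leftEnd upper × leftEnd upper < rightEnd lower × rightEnd lower < rightEnd upper

arcs-interleave⇔ : ∀ q p x y → q < x → y ≤ p →
  ArcsInterleave (2 * suc q ∸ 1 , 2 * x) (2 * suc p ∸ 1 , 2 * y) ⇔ (q < y × y < x × x ≤ p)
arcs-interleave⇔ q p x y q<x y≤p = interleave (≤-trans (n≤1+n _) (subst (_≤ 2 * x) (*-suc 2 q) (*-monoʳ-≤ 2 q<x)))
                                              (≤-trans (*-monoʳ-≤ 2 y≤p) (n≤1+n _))
  where
  interleave : suc (2 * q) ≤ 2 * x → 2 * y ≤ suc (2 * p) →
               ArcsInterleave (2 * suc q ∸ 1 , 2 * x) (2 * suc p ∸ 1 , 2 * y) ⇔ (q < y × y < x × x ≤ p)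
  interleave lower-ordered upper-ordered
    rewrite cong (_∸ 1) (*-suc 2 q) | cong (_∸ 1) (*-suc 2 p)
          | m≤n⇒m⊓n≡m lower-ordered | m≤n⇒m⊔n≡n lower-ordered
          | m≥n⇒m⊓n≡n upper-ordered | m≥n⇒m⊔n≡m upper-ordered
    = mk⇔ (λ (a , b , c) → Equivalence.to odd<double⇔ a , Equivalence.to double<double⇔ b , Equivalence.to double<odd⇔ c)
          (λ (a , b , c) → Equivalence.from odd<double⇔ a , Equivalence.from double<double⇔ b , Equivalence.from double<odd⇔ c)

module Interval (T T' : BT) (|T'|≡|T| : size T' ≡ size T) where

  n : ℕ
  n = size T

  toT' : ∀ {p} → p < n → p < size T'
  toT' = subst (_ <_) (sym |T'|≡|T|)

  E : Edges
  E = underlyingEdges n T T'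

  ends : ℕ → ℕ × ℕ
  ends t = subtreeStart T' t , subtreeEnd T t

  edge-ends : ∀ e → edge E e ≡ ends (toℕ e)
  edge-ends = edge-map-applyUpTo ends (λ i → i) n

  edge-label< : ∀ e → toℕ e < n
  edge-label< e = subst (toℕ e <_) (length-map-applyUpTo ends (λ i → i) n) (toℕ<n e)

  adjacent : ∀ {t} → t < n → Adj E (subtreeStart T' t) (subtreeEnd T t)
  adjacent t<n with index-map-applyUpTo ends (λ i → i) t<n
  ... | e , toℕ-e≡t = e , inj₁ (trans (edge-ends e) (cong ends toℕ-e≡t))

  adjacent˘ : ∀ {t} → t < n → Adj E (subtreeEnd T t) (subtreeStart T' t)
  adjacent˘ t<n with index-map-applyUpTo ends (λ i → i) t<n
  ... | e , toℕ-e≡t = e , inj₂ (trans (edge-ends e) (cong ends toℕ-e≡t))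

  joins-ends : ∀ {e x y} → Joins E e x y →
               (x ≡ subtreeStart T' (toℕ e) × y ≡ subtreeEnd T (toℕ e)) ⊎
               (y ≡ subtreeStart T' (toℕ e) × x ≡ subtreeEnd T (toℕ e))
  joins-ends {e} (inj₁ e≡xy) = inj₁ (cong proj₁ (trans (sym e≡xy) (edge-ends e)) , cong proj₂ (trans (sym e≡xy) (edge-ends e)))
  joins-ends {e} (inj₂ e≡yx) = inj₂ (cong proj₁ (trans (sym e≡yx) (edge-ends e)) , cong proj₂ (trans (sym e≡yx) (edge-ends e)))

  Invariant : (ℕ → Set) → Set
  Invariant W = ∀ {t} → t < n → W (subtreeStart T' t) ⇔ W (subtreeEnd T t)

  joins-⇔ : ∀ {W : ℕ → Set} {e x y} → Joins E e x y →
            W (subtreeStart T' (toℕ e)) ⇔ W (subtreeEnd T (toℕ e)) → W x ⇔ W y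
  joins-⇔ j ends⇔ with joins-ends j
  ... | inj₁ (refl , refl) = ends⇔
  ... | inj₂ (refl , refl) = ⇔-sym ends⇔

  joins-⇔⁻¹ : ∀ {W : ℕ → Set} {e x y} → Joins E e x y →
              W x ⇔ W y → W (subtreeStart T' (toℕ e)) ⇔ W (subtreeEnd T (toℕ e))
  joins-⇔⁻¹ j xy⇔ with joins-ends j
  ... | inj₁ (refl , refl) = xy⇔
  ... | inj₂ (refl , refl) = ⇔-sym xy⇔

  invariant-joins : ∀ {W} → Invariant W → ∀ {e x y} → Joins E e x y → W x ⇔ W y
  invariant-joins inv {e} j = joins-⇔ j (inv (edge-label< e))

  invariant-path : ∀ {W} → Invariant W → ∀ {x y} → Star (Adj E) x y → W x ⇔ W y
  invariant-path inv ε                = ⇔-id _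
  invariant-path inv ((_ , j) ◅ path) = invariant-path inv path ⇔-∘ invariant-joins inv j

  Dominated : Set
  Dominated = ∀ {p} → p < n → subtreeEnd T p ≤ subtreeEnd T' p

  -- S sits in T' as the subtree occupying the positions off , … , off + size S − 1.
  SubtreeAt : BT → ℕ → Set
  SubtreeAt S off = ∀ {p} → p < size S →
                    leftSize T' (off + p) ≡ leftSize S p × rightSize T' (off + p) ≡ rightSize S p

  whole : SubtreeAt T' 0
  whole _ = refl , refl

  subtreeAt-left : ∀ {l r off} → SubtreeAt (node l r) off → SubtreeAt l off
  subtreeAt-left {l} {r} at p<L with at (<-trans p<L (left<node l r))
  ... | left≡ , right≡ = trans left≡ (leftSize-left l r p<L) , trans right≡ (rightSize-left l r p<L)

  subtreeAt-right : ∀ {l r off} → SubtreeAt (node l r) off → SubtreeAt r (off + suc (size l))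
  subtreeAt-right {l} {r} {off} at {q} q<R rewrite offset-right off (size l) q with at (right<node l r q<R)
  ... | left≡ , right≡ = trans left≡ (leftSize-right l r q) , trans right≡ (rightSize-right l r q)

  subtreeAt-start : ∀ S {off p} → SubtreeAt S off → p < size S → subtreeStart T' (off + p) ≡ off + subtreeStart S p
  subtreeAt-start S {off} {p} at p<n =
    trans (cong (off + p ∸_) (proj₁ (at p<n))) (+-∸-assoc off (leftSize≤ S p p<n))

  subtreeAt-end : ∀ S {off p} → SubtreeAt S off → p < size S → subtreeEnd T' (off + p) ≡ off + subtreeEnd S p
  subtreeAt-end S {off} {p} at p<n =
    trans (cong (suc (off + p) +_) (proj₂ (at p<n)))
          (trans (cong suc (+-assoc off p (rightSize S p))) (sym (+-suc off _)))

  ConnectedOn : ℕ → ℕ → Set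
  ConnectedOn a b = ∀ {u v} → a ≤ u → u ≤ b → a ≤ v → v ≤ b → Star (Adj E) u v

  CycleWithin : Cycle E → ℕ → ℕ → Set
  CycleWithin cy a b = ∀ i → a ≤ toℕ (Cycle.es cy i) × toℕ (Cycle.es cy i) < b

  module _ (dominated : Dominated) where

    -- The root K of a subtree S of T' splits the range of S: its edge is the only
    -- one joining a vertex ≤ K to a vertex > K.
    module Root {l r off} (at : SubtreeAt (node l r) off) (fits : off + size (node l r) ≤ n) where

      K top : ℕ
      K   = off + size l
      top = off + size (node l r)

      K<n : K < n
      K<n = <-≤-trans (+-monoʳ-< off (left<node l r)) fits

      start-K : subtreeStart T' K ≡ off
      start-K = trans (subtreeAt-start (node l r) at (left<node l r)) (trans (cong (off +_) (subtreeStart-root l r)) (+-identityʳ off))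

      end-K≤top : subtreeEnd T K ≤ top
      end-K≤top = ≤-trans (dominated K<n)
        (≤-reflexive (trans (subtreeAt-end (node l r) at (left<node l r)) (cong (off +_) (subtreeEnd-root l r))))

      left-fits : off + size l ≤ n
      left-fits = ≤-trans (+-monoʳ-≤ off (<⇒≤ (left<node l r))) fits

      right-offset : off + suc (size l) ≡ suc K
      right-offset = +-suc off (size l)

      right-top : off + suc (size l) + size r ≡ top
      right-top = +-assoc off (suc (size l)) (size r)

      right-fits : off + suc (size l) + size r ≤ n
      right-fits = subst (_≤ n) (sym right-top) fits

      data EdgeSide (t : ℕ) : Set where
        leftEdge  : t < K → subtreeStart T' t ≤ K → subtreeEnd T t ≤ K → EdgeSide t
        rootEdge  : t ≡ K → EdgeSide t
        rightEdge : K < t → K < subtreeStart T' t → EdgeSide t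

      edgeSide′ : ∀ {p} → p < size (node l r) → EdgeSide (off + p)
      edgeSide′ {p} p<n with position (size l) (size r) p<n
      ... | left p<L      = leftEdge (+-monoʳ-< off p<L)
        (≤-trans (subtreeStart≤ T' (off + p)) (+-monoʳ-≤ off (<⇒≤ p<L)))
        (begin
          subtreeEnd T (off + p)          ≤⟨ dominated (<-≤-trans (+-monoʳ-< off p<n) fits) ⟩
          subtreeEnd T' (off + p)         ≡⟨ subtreeAt-end (node l r) at p<n ⟩
          off + subtreeEnd (node l r) p   ≡⟨ cong (off +_) (subtreeEnd-left l r p<L) ⟩
          off + subtreeEnd l p            ≤⟨ +-monoʳ-≤ off (subtreeEnd≤size l p p<L) ⟩
          K                               ∎)
        where open ≤-Reasoning
      ... | root          = rootEdge refl
      ... | right {q} q<R = rightEdge (+-monoʳ-< off (m<m+n (size l) z<s))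
        (subst (K <_) (sym (trans (subtreeAt-start (node l r) at p<n) (cong (off +_) (subtreeStart-right l r q<R))))
          (+-monoʳ-< off (s≤s (m≤m+n (size l) _))))

      edgeSide : ∀ {t} → off ≤ t → t < top → EdgeSide t
      edgeSide {t} off≤t t<top = subst EdgeSide (m+[n∸m]≡n off≤t)
        (edgeSide′ (+-cancelˡ-< off _ _ (subst (_< top) (sym (m+[n∸m]≡n off≤t)) t<top)))

      connected-across : ConnectedOn off K → ConnectedOn (suc K) top → ConnectedOn off top
      connected-across inLeft inRight {u} {v} off≤u u≤top off≤v v≤top with u ≤? K | v ≤? K
      ... | yes u≤K | yes v≤K = inLeft off≤u u≤K off≤v v≤K
      ... | no  u≰K | no  v≰K = inRight (≰⇒> u≰K) u≤top (≰⇒> v≰K) v≤top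
      ... | yes u≤K | no  v≰K = inLeft off≤u u≤K ≤-refl (m≤m+n off (size l))
        ◅◅ (subst (λ x → Adj E x (subtreeEnd T K)) start-K (adjacent K<n)
        ◅ inRight (p<subtreeEnd T K) end-K≤top (≰⇒> v≰K) v≤top)
      ... | no  u≰K | yes v≤K = inRight (≰⇒> u≰K) u≤top (p<subtreeEnd T K) end-K≤top
        ◅◅ (subst (Adj E (subtreeEnd T K)) start-K (adjacent˘ K<n)
        ◅ inLeft ≤-refl (m≤m+n off (size l)) off≤v v≤K)

      module _ (cy : Cycle E) (within : CycleWithin cy off top) where
        open Cycle cy

        private
          label : Fin (suc k) → ℕ
          label j = toℕ (es j)

          side : ∀ j → EdgeSide (label j)
          side j = edgeSide (proj₁ (within j)) (proj₂ (within j))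

          Low : ℕ → Set
          Low v = v ≤ K

          K<end : ∀ {t} → K < t → K < subtreeEnd T t
          K<end {t} K<t = <-trans K<t (p<subtreeEnd T t)

          source : ∀ j → vs j ≡ subtreeStart T' (label j) ⊎ vs j ≡ subtreeEnd T (label j)
          source j with joins-ends (joins j)
          ... | inj₁ (vs≡start , _) = inj₁ vs≡start
          ... | inj₂ (_ , vs≡end)   = inj₂ vs≡end

          keeps-side : ∀ j → label j ≢ K → Preserves cy Low j
          keeps-side j t≢K with side j
          ... | leftEdge _ start≤K end≤K = joins-⇔ {Low} (joins j) (mk⇔ (λ _ → end≤K) (λ _ → start≤K))
          ... | rootEdge t≡K             = contradiction t≡K t≢K
          ... | rightEdge K<t K<start    = joins-⇔ {Low} (joins j)
                  (mk⇔ (<-≤-absurd K<start) (<-≤-absurd (K<end K<t)))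

          avoids-root : ∀ j → label j ≢ K
          avoids-root j t≡K = <-≤-absurd (p<subtreeEnd T K)
            (Equivalence.to (subst (λ t → Low (subtreeStart T' t) ⇔ Low (subtreeEnd T t)) t≡K crossing)
              (subst Low (sym start-K) (m≤m+n off (size l))))
            where
            crossing : Low (subtreeStart T' (label j)) ⇔ Low (subtreeEnd T (label j))
            crossing = joins-⇔⁻¹ {Low} (joins j) (preserved-at-remaining-edge cy Low j λ i i≢j →
              keeps-side i λ tᵢ≡K → i≢j (es-inj (toℕ-injective (trans tᵢ≡K (sym t≡K)))))

          same-side : ∀ j → Low (vs fzero) ⇔ Low (vs j)
          same-side = preserved-along-cycle cy Low (λ j → keeps-side j (avoids-root j))

          low⇒left : ∀ j → Low (vs j) → label j < K
          low⇒left j low with side j | source j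
          ... | leftEdge t<K _ _   | _           = t<K
          ... | rootEdge t≡K       | _           = contradiction t≡K (avoids-root j)
          ... | rightEdge _ K<start | inj₁ vs≡start = <-≤-absurd K<start (subst Low vs≡start low)
          ... | rightEdge K<t _     | inj₂ vs≡end   = <-≤-absurd (K<end K<t) (subst Low vs≡end low)

          high⇒right : ∀ j → ¬ Low (vs j) → K < label j
          high⇒right j high with side j | source j
          ... | leftEdge _ start≤K _ | inj₁ vs≡start = contradiction (subst Low (sym vs≡start) start≤K) high
          ... | leftEdge _ _ end≤K   | inj₂ vs≡end   = contradiction (subst Low (sym vs≡end) end≤K) high
          ... | rootEdge t≡K         | _             = contradiction t≡K (avoids-root j)
          ... | rightEdge K<t _      | _             = K<t

        cycle-splits : CycleWithin cy off K ⊎ CycleWithin cy (suc K) top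
        cycle-splits with vs fzero ≤? K
        ... | yes low = inj₁ λ j → proj₁ (within j) , low⇒left j (Equivalence.to (same-side j) low)
        ... | no high = inj₂ λ j → high⇒right j (high ∘ Equivalence.from (same-side j)) , proj₂ (within j)

    connected-within : ∀ S off → SubtreeAt S off → off + size S ≤ n → ConnectedOn off (off + size S)
    connected-within leaf off _ _ {u} {v} off≤u u≤off off≤v v≤off
      with ≤-antisym (subst (u ≤_) (+-identityʳ off) u≤off) off≤u
         | ≤-antisym (subst (v ≤_) (+-identityʳ off) v≤off) off≤v
    ... | refl | refl = ε
    connected-within (node l r) off at fits = connected-across
      (connected-within l off (subtreeAt-left at) left-fits)
      (subst₂ ConnectedOn right-offset right-top
        (connected-within r (off + suc (size l)) (subtreeAt-right at) right-fits))
      where open Root {l} {r} at fits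

    acyclic-within : ∀ S off → SubtreeAt S off → off + size S ≤ n → ∀ cy → ¬ CycleWithin cy off (off + size S)
    acyclic-within leaf off _ _ cy within =
      <-≤-absurd (subst (_ <_) (+-identityʳ off) (proj₂ (within fzero))) (proj₁ (within fzero))
    acyclic-within (node l r) off at fits cy within =
      [ acyclic-within l off (subtreeAt-left at) left-fits cy
      , acyclic-within r (off + suc (size l)) (subtreeAt-right at) right-fits cy
          ∘ subst₂ (CycleWithin cy) (sym right-offset) (sym right-top)
      ]′ (cycle-splits cy within)
      where open Root {l} {r} at fits

  private
    neither : ∀ {A B : Set} → ¬ A → ¬ B → A ⇔ B
    neither ¬a ¬b = mk⇔ (⊥-elim ∘ ¬a) (⊥-elim ∘ ¬b)

    both : ∀ {A B : Set} → A → B → A ⇔ B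
    both a b = mk⇔ (λ _ → b) (λ _ → a)

  Window : ℕ → ℕ → Set
  Window p v = p < v × v ≤ subtreeEnd T' p

  window-invariant : ∀ {p} → p < n → subtreeEnd T' p < subtreeEnd T p →
                     (∀ q → p < q → q < n → subtreeEnd T q ≤ subtreeEnd T' q) → Invariant (Window p)
  window-invariant {p} p<n end'<end dominatedAbove {t} t<n with <-cmp t p
  ... | tri< t<p _ _ = neither
    (λ (p<start , _) → <-≤-absurd p<start (≤-trans (subtreeStart≤ T' t) (<⇒≤ t<p)))
    (λ (p<end , end≤end') → <-≤-absurd end'<end
       (≤-trans (proj₁ (right-descendant-nested T t p p<n t<p p<end)) end≤end'))
  ... | tri≈ _ refl _ = neither
    (λ (p<start , _) → <-≤-absurd p<start (subtreeStart≤ T' p))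
    (λ (_ , end≤end') → <-≤-absurd end'<end end≤end')
  ... | tri> _ _ p<t with t <? subtreeEnd T' p
  ...   | yes t<end' = both
    (proj₂ nested , ≤-trans (subtreeStart≤ T' t) (<⇒≤ t<end'))
    (<-trans p<t (p<subtreeEnd T t) , ≤-trans (dominatedAbove t p<t t<n) (proj₁ nested))
    where
    nested : subtreeEnd T' t ≤ subtreeEnd T' p × p < subtreeStart T' t
    nested = right-descendant-nested T' p t (toT' t<n) p<t t<end'
  ...   | no t≮end' = neither
    (λ (p<start , start≤end') → t≮end' (subtreeStart-inside⇒descendant T' p t (toT' t<n) p<start start≤end'))
    (λ (_ , end≤end') → t≮end' (<-≤-trans (p<subtreeEnd T t) end≤end'))

  connected⇒dominated : Connected n E → Dominated
  connected⇒dominated connected {p} = downward-induction n dominated-at p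
    where
    dominated-at : ∀ p → p < n → (∀ q → p < q → q < n → subtreeEnd T q ≤ subtreeEnd T' q) →
                   subtreeEnd T p ≤ subtreeEnd T' p
    dominated-at p p<n dominatedAbove with subtreeEnd T p ≤? subtreeEnd T' p
    ... | yes end≤end' = end≤end'
    ... | no  end≰end' = <-≤-absurd (s≤s z≤n)
      (proj₁ (Equivalence.from (invariant-path {Window p} (window-invariant p<n (≰⇒> end≰end') dominatedAbove)
                                               (connected 0 (suc p) z≤n p<n))
                               (n<1+n p , p<subtreeEnd T' p)))

  dominated⇒tree : Dominated → MeanderingTree n T T'
  dominated⇒tree dominated = connected , acyclic
    where
    fits : 0 + size T' ≤ n
    fits = ≤-reflexive |T'|≡|T|

    connected : Connected n E
    connected u v u≤n v≤n = connected-within dominated T' 0 whole fits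
      z≤n (subst (u ≤_) (sym |T'|≡|T|) u≤n) z≤n (subst (v ≤_) (sym |T'|≡|T|) v≤n)

    acyclic : Acyclic E
    acyclic cy = acyclic-within dominated T' 0 whole fits cy
      λ i → z≤n , toT' (edge-label< (Cycle.es cy i))

  Crossing : Set
  Crossing = ∃[ q ] ∃[ p ] q < n × p < n ×
             q < subtreeStart T' p × subtreeStart T' p < subtreeEnd T q × subtreeEnd T q ≤ p

  nonKrewerasPair⇔crossing : NonKrewerasPair n T T' ⇔ Crossing
  nonKrewerasPair⇔crossing = mk⇔ to from
    where
    interleave⇔ : ∀ q p → ArcsInterleave (lowerArc T (suc q)) (upperArc T' (suc p)) ⇔
                  (q < subtreeStart T' p × subtreeStart T' p < subtreeEnd T q × subtreeEnd T q ≤ p)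
    interleave⇔ q p = arcs-interleave⇔ q p _ _ (p<subtreeEnd T q) (subtreeStart≤ T' p)

    to : NonKrewerasPair n T T' → Crossing
    to (suc q , suc p , _ , q<n , _ , p<n , interleaving) = q , p , q<n , p<n , Equivalence.to (interleave⇔ q p) interleaving

    from : Crossing → NonKrewerasPair n T T'
    from (q , p , q<n , p<n , crossing) = suc q , suc p , s≤s z≤n , q<n , s≤s z≤n , p<n , Equivalence.from (interleave⇔ q p) crossing

  refines⇒dominated : EndRefines T T' → Dominated
  refines⇒dominated refines {p} p<n = begin
    subtreeEnd T p          ≤⟨ p<subtreeEnd T' last ⟩
    subtreeEnd T' last      ≡⟨ refines last<n p<n (subtreeEnd-last T p p<n) ⟩
    subtreeEnd T' p         ∎
    where
    open ≤-Reasoning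
    last : ℕ
    last = p + rightSize T p
    last<n : last < n
    last<n = subtreeEnd≤size T p p<n

  refines⇒noCrossing : EndRefines T T' → ¬ Crossing
  refines⇒noCrossing refines (q , p , q<n , p<n , q<start' , start'<end , end≤p) =
    <-≤-absurd (subtreeStart-inside⇒descendant T' q p (toT' p<n) q<start'
                  (<⇒≤ (<-≤-trans start'<end (refines⇒dominated refines q<n))))
               end'≤p
    where
    last : ℕ
    last = q + rightSize T q
    end'≤p : subtreeEnd T' q ≤ p
    end'≤p = begin
      subtreeEnd T' q    ≡⟨ refines q<n (subtreeEnd≤size T q q<n) (sym (subtreeEnd-last T q q<n)) ⟩
      subtreeEnd T' last ≤⟨ left-descendant-ends-before T' last p (toT' p<n) end≤p (≤-pred start'<end) ⟩
      p                  ∎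
      where open ≤-Reasoning

  -- If q₀ < q₁ share a right branch of T but not of T', the upper arc ending at
  -- subtreeEnd T' q₁ crosses the lower arc of q₀.
  dominated×noCrossing⇒sameEnd : Dominated → ¬ Crossing → ∀ {q₀ q₁} → q₀ < q₁ → q₁ < n →
                                 subtreeEnd T q₀ ≡ subtreeEnd T q₁ → subtreeEnd T' q₀ ≡ subtreeEnd T' q₁
  dominated×noCrossing⇒sameEnd dominated noCrossing {q₀} {q₁} q₀<q₁ q₁<n end≡ =
    ≤-antisym (≮⇒≥ (noCrossing ∘ crossing)) (proj₁ (right-descendant-nested T' q₀ q₁ (toT' q₁<n) q₀<q₁ q₁<end'₀))
    where
    q₀<n : q₀ < n
    q₀<n = <-trans q₀<q₁ q₁<n

    q₁<end'₀ : q₁ < subtreeEnd T' q₀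
    q₁<end'₀ = <-≤-trans (p<subtreeEnd T q₁) (≤-trans (≤-reflexive (sym end≡)) (dominated q₀<n))

    w : ℕ
    w = subtreeEnd T' q₁

    crossing : w < subtreeEnd T' q₀ → Crossing
    crossing w<end'₀ =
      q₀ , w , q₀<n , subst (w <_) |T'|≡|T| w<|T'| ,
      proj₂ (right-descendant-nested T' q₀ w w<|T'| (<-trans q₀<q₁ (p<subtreeEnd T' q₁)) w<end'₀) ,
      (begin-strict
        subtreeStart T' w  ≤⟨ subtreeStart-subtreeEnd≤ T' q₁ (toT' q₁<n) w<|T'| ⟩
        subtreeStart T' q₁ ≤⟨ subtreeStart≤ T' q₁ ⟩
        q₁                 <⟨ p<subtreeEnd T q₁ ⟩
        subtreeEnd T q₁    ≡⟨ end≡ ⟨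
        subtreeEnd T q₀    ∎) ,
      ≤-trans (≤-reflexive end≡) (dominated q₁<n)
      where
      open ≤-Reasoning
      w<|T'| : w < size T'
      w<|T'| = <-≤-trans w<end'₀ (subtreeEnd≤size T' q₀ (toT' q₀<n))

  dominated×noCrossing⇒refines : Dominated → ¬ Crossing → EndRefines T T'
  dominated×noCrossing⇒refines dominated noCrossing {p} {q} p<n q<n end≡ with <-cmp p q
  ... | tri< p<q _ _  = dominated×noCrossing⇒sameEnd dominated noCrossing p<q q<n end≡
  ... | tri≈ _ refl _ = refl
  ... | tri> _ _ q<p  = sym (dominated×noCrossing⇒sameEnd dominated noCrossing q<p p<n (sym end≡))

lemma4p14 : (n : ℕ) (T T' : BT) → size T ≡ n → size T' ≡ n →
    Kreweras T T' ⇔ (MeanderingTree n T T' × ¬ NonKrewerasPair n T T')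
lemma4p14 .(size T) T T' refl |T'|≡n = mk⇔
  (λ kreweras → let refines = Kreweras⇒endRefines kreweras in
     dominated⇒tree (refines⇒dominated refines) ,
     refines⇒noCrossing refines ∘ Equivalence.to nonKrewerasPair⇔crossing)
  (λ ((connected , _) , noPair) → endRefines⇒Kreweras (sym |T'|≡n)
     (dominated×noCrossing⇒refines (connected⇒dominated connected)
                                    (noPair ∘ Equivalence.from nonKrewerasPair⇔crossing)))
  where open Interval T T' |T'|≡n
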